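{- Let $m$ be a positive integer and $x>1$ an integer. Then $J_{m+1}(x)$ is the element of $\{1,2,\dots,x\}$ congruent to $m-j_m(x)$ modulo $x$.
   Context: The triangle $T_m$ (rotation number $m$) is the array whose row $x$ ($x=1,2,\dots$) has $x$ entries in columns $0,\dots,x-1$, defined by $T_m(1,0)=1$; for $x>1$ and $0\le c\le x-2$, $T_m(x,c)=T_m(x-1,c+m)$; and $T_m(x,x-1)=1+T_m(x-1,0)$, where $T_m(x,c)$ for any integer $c$ denotes the entry in row $x$, column ($c$ mod $x$). Each row contains exactly one entry equal to $1$; $j_m(x)\in\{0,\dots,x-1\}$ denotes its column in row $x$. Josephus problem: the integers $1,\dots,x$ are placed clockwise in a circle; starting the count at $1$ (which is counted as the first) and counting clockwise, every $n$th number is eliminated, the count continuing with the numbers that remain, until one number is left; that number is $J_n(x)$. -}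

module Defs where

open import Data.Nat using (ℕ; zero; suc; _+_; _∸_; _<ᵇ_)
open import Data.Nat.DivMod using (_%_; _mod_)
open import Data.Bool using (if_then_else_)
open import Data.Fin using (Fin; toℕ)
open import Data.Vec using (Vec; []; _∷_; removeAt; tabulate)

-- T m x c = T_m(x, c mod x) for x ≥ 1 (row x, column c taken mod x).
-- Row 0 does not exist; we set T m 0 c = 0 arbitrarily.
T : ℕ → ℕ → ℕ → ℕ
T m zero c = 0
T m (suc zero) c = 1
T m (suc (suc k)) c =
  let c' = c % suc (suc k) in
  if c' <ᵇ suc k then T m (suc k) (c' + m) else suc (T m (suc k) 0)

-- The circle is a vector listing the remaining numbers
-- in clockwise order; s is the index at which the count starts (counted as
-- the first).  The n-th counted element, at index (s + n - 1) mod length,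
-- is eliminated; counting resumes at the element that followed it, which
-- now sits at the same index (taken mod the new length at the next step).
josephusGo : (n k : ℕ) → Vec ℕ (suc k) → ℕ → ℕ
josephusGo n zero (a ∷ []) s = a
josephusGo n (suc k) v s =
  let i = (s + n ∸ 1) mod suc (suc k) in
  josephusGo n k (removeAt v i) (toℕ i)

-- J n x : survivor of the Josephus problem with 1..x in a circle, every
-- n-th eliminated, counting starting at 1.  (J n 0 = 0 arbitrarily.)
J : ℕ → ℕ → ℕ
J n zero = 0
J n (suc k) = josephusGo n k (tabulate (λ i → suc (toℕ i))) 0

{-# OPTIONS --safe #-}
-- Put g(1) = 0 and g(x) = m + 1 + (g(x − 1) mod (x − 1)).  The first number
-- eliminated sits at position m (mod x), and the game continues on a circle of
-- x − 1 numbers counted from the next position; hence the survivor J_{m+1}(x)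
-- is 1 + (g(x) mod x).  In row x of T_m the entry 1 lies in a column c ≤ x − 2
-- (the last column holds 1 + T_m(x − 1, 0) > 1), with c + m ≡ j_m(x − 1)
-- (mod x − 1).  By induction 1 + g(x − 1) + j_m(x − 1) ≡ m, so
-- (g(x − 1) mod (x − 1)) + c + 1 ≡ 0 (mod x − 1); lying strictly between 0 and
-- 2(x − 1), it equals x − 1.  Hence 1 + g(x) + c = m + x ≡ m (mod x).
module Submission where

open import Defs
open import Data.Nat using (ℕ; zero; suc; _+_; _*_; _∸_; _≤_; _<_; NonZero; z≤n; s≤s; z<s; _<ᵇ_)
open import Data.Nat.DivMod
open import Data.Nat.Divisibility using (_∣_; divides-refl; n∣m*n; ∣m+n∣m⇒∣n)
open import Data.Nat.Properties
open import Data.Nat.Solver using (module +-*-Solver)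
open import Data.Product using (_×_; _,_)
open import Data.Bool using (true; false)
import Data.Bool as Bool
open import Data.Fin using (Fin; toℕ; punchIn)
open import Data.Fin.Properties using (toℕ-injective; toℕ-fromℕ<; toℕ<n)
open import Data.Vec using (Vec; []; _∷_; lookup; removeAt; tabulate)
open import Data.Vec.Properties using (lookup∘tabulate)
open import Data.Empty using (⊥-elim)
open import Relation.Binary.PropositionalEquality hiding (J)
open import Relation.Nullary using (yes; no)

[m%d+n]%d≡[m+n]%d : ∀ m n d .{{_ : NonZero d}} → (m % d + n) % d ≡ (m + n) % d
[m%d+n]%d≡[m+n]%d m n d = begin
  (m % d + n) % d         ≡⟨ %-distribˡ-+ (m % d) n d ⟩
  (m % d % d + n % d) % d ≡⟨ cong (λ z → (z + n % d) % d) (m%n%n≡m%n m d) ⟩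
  (m % d + n % d) % d     ≡⟨ sym (%-distribˡ-+ m n d) ⟩
  (m + n) % d             ∎
  where open ≡-Reasoning

[m+n%d]%d≡[m+n]%d : ∀ m n d .{{_ : NonZero d}} → (m + n % d) % d ≡ (m + n) % d
[m+n%d]%d≡[m+n]%d m n d = begin
  (m + n % d) % d ≡⟨ %-congˡ (+-comm m (n % d)) ⟩
  (n % d + m) % d ≡⟨ [m%d+n]%d≡[m+n]%d n m d ⟩
  (n + m) % d     ≡⟨ %-congˡ (+-comm n m) ⟩
  (m + n) % d     ∎
  where open ≡-Reasoning

[m+n]%d≡n%d⇒d∣m : ∀ m n d .{{_ : NonZero d}} → (m + n) % d ≡ n % d → d ∣ m
[m+n]%d≡n%d⇒d∣m m n d eq =
  ∣m+n∣m⇒∣n (subst (d ∣_) (sym m+qn≡q′n) (n∣m*n ((m + n) / d))) (n∣m*n (n / d))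
  where
  open ≡-Reasoning
  m+qn≡q′n : n / d * d + m ≡ (m + n) / d * d
  m+qn≡q′n = +-cancelˡ-≡ (n % d) _ _ (begin
    n % d + (n / d * d + m) ≡⟨ sym (+-assoc (n % d) _ m) ⟩
    n % d + n / d * d + m   ≡⟨ cong (_+ m) (sym (m≡m%n+[m/n]*n n d)) ⟩
    n + m                   ≡⟨ +-comm n m ⟩
    m + n                   ≡⟨ m≡m%n+[m/n]*n (m + n) d ⟩
    (m + n) % d + (m + n) / d * d ≡⟨ cong (_+ (m + n) / d * d) eq ⟩
    n % d + (m + n) / d * d ∎)

n∣m⇒0<m<n+n⇒m≡n : ∀ {m n} → n ∣ m → 0 < m → m < n + n → m ≡ n
n∣m⇒0<m<n+n⇒m≡n (divides-refl 0) () _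
n∣m⇒0<m<n+n⇒m≡n (divides-refl 1) _  _ = +-identityʳ _
n∣m⇒0<m<n+n⇒m≡n {n = n} (divides-refl (suc (suc q))) _ lt =
  ⊥-elim (<⇒≱ lt (+-monoʳ-≤ n (m≤m+n n (q * n))))

removeAt-punchIn : ∀ {a} {A : Set a} {n} (xs : Vec A (suc n)) i j →
                   lookup (removeAt xs i) j ≡ lookup xs (punchIn i j)
removeAt-punchIn (x ∷ xs)     Fin.zero    j           = refl
removeAt-punchIn (x ∷ y ∷ xs) (Fin.suc i) Fin.zero    = refl
removeAt-punchIn (x ∷ y ∷ xs) (Fin.suc i) (Fin.suc j) = removeAt-punchIn (y ∷ xs) i j

toℕ-punchIn-< : ∀ {n} (i : Fin (suc n)) j → toℕ j < toℕ i → toℕ (punchIn i j) ≡ toℕ j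
toℕ-punchIn-< (Fin.suc i) Fin.zero    _         = refl
toℕ-punchIn-< (Fin.suc i) (Fin.suc j) (s≤s j<i) = cong suc (toℕ-punchIn-< i j j<i)

toℕ-punchIn-≥ : ∀ {n} (i : Fin (suc n)) j → toℕ i ≤ toℕ j → toℕ (punchIn i j) ≡ suc (toℕ j)
toℕ-punchIn-≥ Fin.zero    j           _         = refl
toℕ-punchIn-≥ (Fin.suc i) (Fin.suc j) (s≤s i≤j) = cong suc (toℕ-punchIn-≥ i j i≤j)

-- t steps after position i in the circle with i removed are t + 1 steps after
-- i in the full circle.
toℕ-punchIn-shift : ∀ {k} (i : Fin (suc (suc k))) (p : Fin (suc k)) t → t < suc k →
                    toℕ p ≡ (toℕ i + t) % suc k →
                    toℕ (punchIn i p) ≡ (toℕ i + suc t) % suc (suc k)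
toℕ-punchIn-shift {k} i p t t<k+1 p≡ with toℕ i + t <? suc k
... | yes lt = begin
  toℕ (punchIn i p)        ≡⟨ toℕ-punchIn-≥ i p (subst (toℕ i ≤_) (sym p≡i+t) (m≤m+n (toℕ i) t)) ⟩
  suc (toℕ p)              ≡⟨ cong suc p≡i+t ⟩
  suc (toℕ i + t)          ≡⟨ sym (+-suc (toℕ i) t) ⟩
  toℕ i + suc t            ≡⟨ sym (m<n⇒m%n≡m (subst (_< suc (suc k)) (sym (+-suc (toℕ i) t)) (s≤s lt))) ⟩
  (toℕ i + suc t) % suc (suc k) ∎
  where
  open ≡-Reasoning
  p≡i+t : toℕ p ≡ toℕ i + t
  p≡i+t = trans p≡ (m<n⇒m%n≡m lt)
... | no ¬lt = begin
  toℕ (punchIn i p)        ≡⟨ toℕ-punchIn-< i p (subst (_< toℕ i) (sym p≡r) r<i) ⟩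
  toℕ p                    ≡⟨ p≡r ⟩
  r                        ≡⟨ sym (m<n⇒m%n≡m (<-≤-trans r<i (<⇒≤ (toℕ<n i)))) ⟩
  r % suc (suc k)          ≡⟨ sym ([m+n]%n≡m%n r (suc (suc k))) ⟩
  (r + suc (suc k)) % suc (suc k) ≡⟨ %-congˡ (trans (+-suc r (suc k)) (cong suc r+k+1≡i+t)) ⟩
  suc (toℕ i + t) % suc (suc k)   ≡⟨ %-congˡ (sym (+-suc (toℕ i) t)) ⟩
  (toℕ i + suc t) % suc (suc k)   ∎
  where
  open ≡-Reasoning
  r : ℕ
  r = toℕ i + t ∸ suc k
  r+k+1≡i+t : r + suc k ≡ toℕ i + t
  r+k+1≡i+t = trans (+-comm r (suc k)) (m+[n∸m]≡n (≮⇒≥ ¬lt))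
  r<i : r < toℕ i
  r<i = +-cancelʳ-< (suc k) r (toℕ i)
          (subst (_< toℕ i + suc k) (sym r+k+1≡i+t) (+-monoʳ-< (toℕ i) t<k+1))
  p≡r : toℕ p ≡ r
  p≡r = begin
    toℕ p                ≡⟨ p≡ ⟩
    (toℕ i + t) % suc k  ≡⟨ %-congˡ (sym r+k+1≡i+t) ⟩
    (r + suc k) % suc k  ≡⟨ [m+n]%n≡m%n r (suc k) ⟩
    r % suc k            ≡⟨ m<n⇒m%n≡m (<-≤-trans r<i (≤-pred (toℕ<n i))) ⟩
    r                    ∎

survivorOffset : ℕ → ℕ → ℕ
survivorOffset n zero    = 0
survivorOffset n (suc k) = n + survivorOffset n k % suc k

josephusGo≡lookup-survivorOffset : ∀ a k (v : Vec ℕ (suc k)) s →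
  josephusGo (suc a) k v s ≡ lookup v ((s + survivorOffset (suc a) k) mod suc k)
josephusGo≡lookup-survivorOffset a zero (x ∷ []) s with (s + 0) mod 1
... | Fin.zero = refl
josephusGo≡lookup-survivorOffset a (suc k) v s = begin
  josephusGo (suc a) (suc k) v s             ≡⟨ josephusGo≡lookup-survivorOffset a k (removeAt v i) (toℕ i) ⟩
  lookup (removeAt v i) ((toℕ i + g) mod suc k) ≡⟨ removeAt-punchIn v i _ ⟩
  lookup v (punchIn i ((toℕ i + g) mod suc k))  ≡⟨ cong (lookup v) (toℕ-injective positions) ⟩
  lookup v ((s + survivorOffset (suc a) (suc k)) mod N) ∎
  where
  open ≡-Reasoning
  N : ℕ
  N = suc (suc k)
  g : ℕ
  g = survivorOffset (suc a) k
  i : Fin N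
  i = (s + suc a ∸ 1) mod N
  i≡s+a : toℕ i ≡ (s + a) % N
  i≡s+a = trans (toℕ-fromℕ< _) (%-congˡ (cong (_∸ 1) (+-suc s a)))
  positions : toℕ (punchIn i ((toℕ i + g) mod suc k)) ≡ toℕ ((s + (suc a + g % suc k)) mod N)
  positions = begin
    toℕ (punchIn i ((toℕ i + g) mod suc k))
      ≡⟨ toℕ-punchIn-shift i _ (g % suc k) (m%n<n g (suc k))
           (trans (toℕ-fromℕ< _) (sym ([m+n%d]%d≡[m+n]%d (toℕ i) g (suc k)))) ⟩
    (toℕ i + suc (g % suc k)) % N       ≡⟨ cong (λ z → (z + suc (g % suc k)) % N) i≡s+a ⟩
    ((s + a) % N + suc (g % suc k)) % N ≡⟨ [m%d+n]%d≡[m+n]%d (s + a) _ N ⟩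
    (s + a + suc (g % suc k)) % N       ≡⟨ %-congˡ (trans (+-assoc s a _) (cong (s +_) (+-suc a _))) ⟩
    (s + (suc a + g % suc k)) % N       ≡⟨ sym (toℕ-fromℕ< _) ⟩
    toℕ ((s + (suc a + g % suc k)) mod N) ∎

J≡1+survivorOffset : ∀ m k → J (suc m) (suc k) ≡ suc (survivorOffset (suc m) k % suc k)
J≡1+survivorOffset m k = begin
  J (suc m) (suc k)                            ≡⟨ josephusGo≡lookup-survivorOffset m k _ 0 ⟩
  lookup (tabulate (λ i → suc (toℕ i))) offset ≡⟨ lookup∘tabulate (λ i → suc (toℕ i)) offset ⟩
  suc (toℕ offset)                             ≡⟨ cong suc (toℕ-fromℕ< _) ⟩
  suc (survivorOffset (suc m) k % suc k)       ∎
  where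
  open ≡-Reasoning
  offset : Fin (suc k)
  offset = survivorOffset (suc m) k mod suc k

T≢0 : ∀ m k c → T m (suc k) c ≢ 0
T≢0 m zero    c ()
T≢0 m (suc k) c with c % suc (suc k) <ᵇ suc k
... | true  = T≢0 m k _
... | false = λ ()

T≡1⇒[1+survivorOffset+c]%≡m% : ∀ m k c → T m (suc k) c ≡ 1 →
  (suc (survivorOffset (suc m) k) + c) % suc k ≡ m % suc k
T≡1⇒[1+survivorOffset+c]%≡m% m zero    c _ = trans (n%1≡0 (suc c)) (sym (n%1≡0 m))
T≡1⇒[1+survivorOffset+c]%≡m% m (suc k) c T≡1 with c % suc (suc k) <ᵇ suc k in c′<ᵇN
... | false = ⊥-elim (T≢0 m k 0 (suc-injective T≡1))
... | true  = begin
  (suc (suc m + g) + c) % M  ≡⟨ sym ([m+n%d]%d≡[m+n]%d (suc (suc m + g)) c M) ⟩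
  (suc (suc m + g) + c′) % M ≡⟨ %-congˡ (rearrange m g c′) ⟩
  (m + suc (g + suc c′)) % M ≡⟨ %-congˡ (cong (λ z → m + suc z) g+c′+1≡N) ⟩
  (m + M) % M                ≡⟨ [m+n]%n≡m%n m M ⟩
  m % M                      ∎
  where
  open ≡-Reasoning
  N M c′ G g : ℕ
  N  = suc k
  M  = suc N
  c′ = c % M
  G  = survivorOffset (suc m) k
  g  = G % N
  rearrange : ∀ m g c′ → suc (suc m + g) + c′ ≡ m + suc (g + suc c′)
  rearrange = solve 3 (λ m g c′ → con 1 :+ (con 1 :+ m :+ g) :+ c′ := m :+ (con 1 :+ (g :+ (con 1 :+ c′)))) refl
    where open +-*-Solver
  c′<N : c′ < N
  c′<N = <ᵇ⇒< c′ N (subst Bool.T (sym c′<ᵇN) _)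
  [g+c′+1+m]%≡m% : (g + suc c′ + m) % N ≡ m % N
  [g+c′+1+m]%≡m% = begin
    (g + suc c′ + m) % N   ≡⟨ %-congˡ (+-assoc g (suc c′) m) ⟩
    (g + suc (c′ + m)) % N ≡⟨ [m%d+n]%d≡[m+n]%d G _ N ⟩
    (G + suc (c′ + m)) % N ≡⟨ %-congˡ (+-suc G (c′ + m)) ⟩
    (suc G + (c′ + m)) % N ≡⟨ T≡1⇒[1+survivorOffset+c]%≡m% m k (c′ + m) T≡1 ⟩
    m % N                  ∎
  g+c′+1≡N : g + suc c′ ≡ N
  g+c′+1≡N = n∣m⇒0<m<n+n⇒m≡n ([m+n]%d≡n%d⇒d∣m _ m N [g+c′+1+m]%≡m%)
               (<-≤-trans z<s (m≤n+m (suc c′) g)) (+-mono-<-≤ (m%n<n G N) c′<N)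

proposition19 : (m x : ℕ) → 1 ≤ m → 1 < x → .{{_ : NonZero x}} →
    (j : ℕ) → j < x → T m x j ≡ 1 →
    (1 ≤ J (suc m) x) × (J (suc m) x ≤ x) × ((J (suc m) x + j) % x ≡ m % x)
proposition19 m (suc k) _ _ j _ T≡1 rewrite J≡1+survivorOffset m k =
  s≤s z≤n , m%n<n G N , (begin
    (suc (G % N) + j) % N ≡⟨ %-congˡ (sym (+-suc (G % N) j)) ⟩
    (G % N + suc j) % N   ≡⟨ [m%d+n]%d≡[m+n]%d G (suc j) N ⟩
    (G + suc j) % N       ≡⟨ %-congˡ (+-suc G j) ⟩
    (suc G + j) % N       ≡⟨ T≡1⇒[1+survivorOffset+c]%≡m% m k j T≡1 ⟩
    m % N                 ∎)
  where
  open ≡-Reasoning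
  N G : ℕ
  N = suc k
  G = survivorOffset (suc m) k
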